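{- Let $D$ be the formal derivative with respect to the grammar $G\colon x\to xy,\ y\to xz,\ z\to zw,\ w\to xz$. Then $$\mathrm{Gen}(z,t)=z\,x^{ -1}\,\mathrm{Gen}(x,t)\,e^{(w-y)t}.$$
   Context: Let $x,y,z,w$ be commuting variables. The formal derivative $D$ is the linear operator on Laurent polynomials in $x,y,z,w$ with $D(uv)=uD(v)+vD(u)$, $D(c)=0$ for constants $c$, and $D(x)=xy$, $D(y)=xz$, $D(z)=zw$, $D(w)=xz$; $D^0$ is the identity. For a Laurent polynomial $u$, $\mathrm{Gen}(u,t)=\sum_{n\ge0}D^n(u)t^n/n!$, a formal power series in $t$. -}

module Defs where

open import Data.Nat as ℕ using (ℕ; zero; suc; _!)
open import Data.Nat.Properties using (_!≢0)
open import Data.Integer as ℤ using (ℤ; +_)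
open import Data.Rational as ℚ using (ℚ)
open import Data.Product using (_×_; _,_)
open import Data.List using (List; []; _∷_; _++_; map; concatMap)
open import Data.Vec using (Vec; []; _∷_)
open import Data.Vec.Properties using (≡-dec)
open import Relation.Nullary using (yes; no)
open import Relation.Binary.PropositionalEquality using (_≡_)

-- Exponent vector (a, b, c, d) for the monomial x^a y^b z^c w^d, a,b,c,d ∈ ℤ.
Exp : Set
Exp = Vec ℤ 4

-- A Laurent polynomial in x,y,z,w with rational coefficients, represented
-- as a finite formal sum of terms  q · x^a y^b z^c w^d  (repetitions allowed).
LPoly : Set
LPoly = List (ℚ × Exp)

coeff : LPoly → Exp → ℚ
coeff [] e = ℚ.0ℚ
coeff ((q , e′) ∷ p) e with ≡-dec ℤ._≟_ e′ e
... | yes _ = q ℚ.+ coeff p e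
... | no  _ = coeff p e

_≈L_ : LPoly → LPoly → Set
p ≈L q = ∀ e → coeff p e ≡ coeff q e

0L : LPoly
0L = []

const : ℚ → LPoly
const q = (q , ℤ.0ℤ ∷ ℤ.0ℤ ∷ ℤ.0ℤ ∷ ℤ.0ℤ ∷ []) ∷ []

_+L_ : LPoly → LPoly → LPoly
_+L_ = _++_

scaleL : ℚ → LPoly → LPoly
scaleL r = map (λ { (q , e) → (r ℚ.* q , e) })

negL : LPoly → LPoly
negL = scaleL (ℚ.- ℚ.1ℚ)

addExp : Exp → Exp → Exp
addExp (a ∷ b ∷ c ∷ d ∷ []) (a′ ∷ b′ ∷ c′ ∷ d′ ∷ []) =
  (a ℤ.+ a′) ∷ (b ℤ.+ b′) ∷ (c ℤ.+ c′) ∷ (d ℤ.+ d′) ∷ []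

_*L_ : LPoly → LPoly → LPoly
p *L q = concatMap (λ { (r , e) → map (λ { (s , f) → (r ℚ.* s , addExp e f) }) q }) p

_^L_ : LPoly → ℕ → LPoly
p ^L zero = const ℚ.1ℚ
p ^L suc n = p *L (p ^L n)

mono : ℤ → ℤ → ℤ → ℤ → LPoly
mono a b c d = (ℚ.1ℚ , a ∷ b ∷ c ∷ d ∷ []) ∷ []

X Y Z W Xinv : LPoly
X = mono (+ 1) (+ 0) (+ 0) (+ 0)
Y = mono (+ 0) (+ 1) (+ 0) (+ 0)
Z = mono (+ 0) (+ 0) (+ 1) (+ 0)
W = mono (+ 0) (+ 0) (+ 0) (+ 1)
Xinv = mono (ℤ.- + 1) (+ 0) (+ 0) (+ 0)

-- The formal derivative of the grammar x → xy, y → xz, z → zw, w → xz,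
-- extended to Laurent polynomials as the (unique) linear derivation.
-- On a term q·x^a y^b z^c w^d the Leibniz rule gives
--   q·a·x^{a-1}·(xy)·y^b z^c w^d + q·b·y^{b-1}·(xz)·x^a z^c w^d
-- + q·c·z^{c-1}·(zw)·x^a y^b w^d + q·d·w^{d-1}·(xz)·x^a y^b z^c.
ℤtoℚ : ℤ → ℚ
ℤtoℚ i = i ℚ./ 1

Dterm : ℚ × Exp → LPoly
Dterm (q , a ∷ b ∷ c ∷ d ∷ []) =
    (q ℚ.* ℤtoℚ a , a ∷ (b ℤ.+ + 1) ∷ c ∷ d ∷ [])
  ∷ (q ℚ.* ℤtoℚ b , (a ℤ.+ + 1) ∷ (b ℤ.- + 1) ∷ (c ℤ.+ + 1) ∷ d ∷ [])
  ∷ (q ℚ.* ℤtoℚ c , a ∷ b ∷ c ∷ (d ℤ.+ + 1) ∷ [])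
  ∷ (q ℚ.* ℤtoℚ d , (a ℤ.+ + 1) ∷ b ∷ (c ℤ.+ + 1) ∷ (d ℤ.- + 1) ∷ [])
  ∷ []

D : LPoly → LPoly
D = concatMap Dterm

Dpow : ℕ → LPoly → LPoly
Dpow zero u = u
Dpow (suc n) u = D (Dpow n u)

-- Formal power series in t with Laurent-polynomial coefficients:
-- a series is its coefficient sequence n ↦ [t^n].
Series : Set
Series = ℕ → LPoly

_≈S_ : Series → Series → Set
f ≈S g = ∀ n → f n ≈L g n

invFact : ℕ → ℚ
invFact n = ℚ._/_ (+ 1) (n !) {{n !≢0}}

Gen : LPoly → Series
Gen u n = scaleL (invFact n) (Dpow n u)

expS : LPoly → Series
expS a n = scaleL (invFact n) (a ^L n)

-- Cauchy product: [t^n](f·g) = Σ_{k=0}^{n} f_k g_{n-k}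
convAux : Series → Series → ℕ → ℕ → LPoly
convAux f g zero m = f zero *L g m
convAux f g (suc k) m = (f (suc k) *L g m) +L convAux f g k (suc m)

_*S_ : Series → Series → Series
(f *S g) n = convAux f g n zero

_·S_ : LPoly → Series → Series
(u ·S f) n = u *L f n

-- For a derivation ∂ of a commutative ring, F = Gen(u,t) is the unique
-- power series with dF/dt = ∂F and F(0) = u (when the integers are invertible).
-- The right-hand side also solves dF/dt = ∂F: by the Leibniz rule in t,
-- d/dt (G·e^{ct}) = ∂G·e^{ct} + c·G·e^{ct} = ∂(G·e^{ct}) + c·G·e^{ct} when ∂c = 0,
-- and multiplying by u with ∂u = u·c absorbs the extra term.  Here u = z x⁻¹,
-- c = w − y, and indeed D(z x⁻¹) = z x⁻¹ (w − y), D(w − y) = 0.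

module Submission where

open import Defs
open import Data.Nat as ℕ using (ℕ; zero; suc; _≤_; z≤n; s≤s)
import Data.Nat.Properties as ℕP
open import Data.Integer as ℤ using (ℤ; +_)
import Data.Integer.Properties as ℤP
open import Data.Rational as ℚ using (ℚ; 0ℚ; 1ℚ)
import Data.Rational.Properties as ℚP
open import Data.Rational.Solver using (module +-*-Solver)
open import Data.Product using (_×_; _,_)
open import Data.List using ([]; _∷_; _++_; map; length)
open import Data.Vec using ([]; _∷_)
open import Data.Vec.Properties using (≡-dec)
open import Data.Empty using (⊥-elim)
open import Relation.Nullary using (yes; no; ¬_)
open import Relation.Binary.PropositionalEquality using (_≡_; refl; sym; trans; cong; cong₂; subst; module ≡-Reasoning)
open import Algebra.Bundles using (CommutativeRing)
open import Level using (0ℓ)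
open import Data.Nat.Coprimality as Cop using (1-coprimeTo)
open import Relation.Binary.Definitions using (DecidableEquality)

module PowerSeries {c ℓ} (R : CommutativeRing c ℓ) where
  open CommutativeRing R hiding (zero) renaming (refl to ≈-refl; sym to ≈-sym; trans to ≈-trans; reflexive to ≈-reflexive)
  open import Algebra.Properties.Semiring.Mult semiring using (×-homo-+) renaming (_×_ to _×ᴿ_)
  open import Algebra.Solver.Ring.NaturalCoefficients.Default commutativeSemiring
  open import Relation.Binary.Reasoning.Setoid setoid

  ι : ℕ → Carrier
  ι n = n ×ᴿ 1#

  ι-+ : ∀ m n → ι (m ℕ.+ n) ≈ ι m + ι n
  ι-+ = ×-homo-+ 1#

  Seq : Set c
  Seq = ℕ → Carrier

  _≋_ : Seq → Seq → Set ℓ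
  F ≋ G = ∀ n → F n ≈ G n

  _·_ : Carrier → Seq → Seq
  (a · F) n = a * F n

  -- Antidiagonal sum:  adiag h k m = Σ_{i=0}^{k} h i (m + k − i).
  adiag : (ℕ → ℕ → Carrier) → ℕ → ℕ → Carrier
  adiag h zero m = h zero m
  adiag h (suc k) m = h (suc k) m + adiag h k (suc m)

  _⋆_ : Seq → Seq → Seq
  (F ⋆ G) n = adiag (λ i j → F i * G j) n 0

  ∂t : Seq → Seq
  ∂t F n = ι (suc n) * F (suc n)

  adiag-cong-on : ∀ {h h′} k m → (∀ i j → i ℕ.+ j ≡ k ℕ.+ m → h i j ≈ h′ i j) →
                  adiag h k m ≈ adiag h′ k m
  adiag-cong-on zero m eq = eq 0 m refl
  adiag-cong-on (suc k) m eq =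
    +-cong (eq (suc k) m refl) (adiag-cong-on k (suc m) (λ i j e → eq i j (trans e (ℕP.+-suc k m))))

  adiag-cong : ∀ {h h′} k m → (∀ i j → h i j ≈ h′ i j) → adiag h k m ≈ adiag h′ k m
  adiag-cong k m eq = adiag-cong-on k m (λ i j _ → eq i j)

  adiag-+ : ∀ h₁ h₂ k m → adiag (λ i j → h₁ i j + h₂ i j) k m ≈ adiag h₁ k m + adiag h₂ k m
  adiag-+ h₁ h₂ zero m = ≈-refl
  adiag-+ h₁ h₂ (suc k) m = begin
    (h₁ (suc k) m + h₂ (suc k) m) + adiag (λ i j → h₁ i j + h₂ i j) k (suc m)
      ≈⟨ +-congˡ (adiag-+ h₁ h₂ k (suc m)) ⟩
    (h₁ (suc k) m + h₂ (suc k) m) + (adiag h₁ k (suc m) + adiag h₂ k (suc m))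
      ≈⟨ solve 4 (λ a b c d → (a :+ b) :+ (c :+ d) := (a :+ c) :+ (b :+ d)) ≈-refl _ _ _ _ ⟩
    (h₁ (suc k) m + adiag h₁ k (suc m)) + (h₂ (suc k) m + adiag h₂ k (suc m)) ∎

  adiag-*ˡ : ∀ a h k m → a * adiag h k m ≈ adiag (λ i j → a * h i j) k m
  adiag-*ˡ a h zero m = ≈-refl
  adiag-*ˡ a h (suc k) m = ≈-trans (distribˡ a _ _) (+-congˡ (adiag-*ˡ a h k (suc m)))

  adiag-reindex : ∀ h k m → adiag h k (suc m) ≡ adiag (λ i j → h i (suc j)) k m
  adiag-reindex h zero m = refl
  adiag-reindex h (suc k) m = cong (λ t → h (suc k) (suc m) + t) (adiag-reindex h k (suc m))

  adiag-peel : ∀ h k m → adiag h (suc k) m ≈ adiag (λ i j → h (suc i) j) k m + h 0 (k ℕ.+ suc m)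
  adiag-peel h zero m = ≈-refl
  adiag-peel h (suc k) m = begin
    h (suc (suc k)) m + adiag h (suc k) (suc m)
      ≈⟨ +-congˡ (adiag-peel h k (suc m)) ⟩
    h (suc (suc k)) m + (adiag (λ i j → h (suc i) j) k (suc m) + h 0 (k ℕ.+ suc (suc m)))
      ≈⟨ ≈-sym (+-assoc _ _ _) ⟩
    adiag (λ i j → h (suc i) j) (suc k) m + h 0 (k ℕ.+ suc (suc m))
      ≈⟨ +-congˡ (≈-reflexive (cong (h 0) (ℕP.+-suc k (suc m)))) ⟩
    adiag (λ i j → h (suc i) j) (suc k) m + h 0 (suc k ℕ.+ suc m) ∎

  ⋆-cong : ∀ {F F′ G G′} → F ≋ F′ → G ≋ G′ → (F ⋆ G) ≋ (F′ ⋆ G′)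
  ⋆-cong F≋F′ G≋G′ n = adiag-cong n 0 (λ i j → *-cong (F≋F′ i) (G≋G′ j))

  ⋆-·ʳ : ∀ a F G → (F ⋆ (a · G)) ≋ (a · (F ⋆ G))
  ⋆-·ʳ a F G n = begin
    adiag (λ i j → F i * (a * G j)) n 0
      ≈⟨ adiag-cong n 0 (λ i j → solve 3 (λ f a g → f :* (a :* g) := a :* (f :* g)) ≈-refl (F i) a (G j)) ⟩
    adiag (λ i j → a * (F i * G j)) n 0
      ≈⟨ ≈-sym (adiag-*ˡ a _ n 0) ⟩
    a * (F ⋆ G) n ∎

  -- Leibniz rule for d/dt on the Cauchy product:  (FG)′ = F′G + FG′.
  -- The weight n+1 = i + j of the term F i · G j is split between the factors.
  ∂t-⋆ : ∀ F G n → ∂t (F ⋆ G) n ≈ (∂t F ⋆ G) n + (F ⋆ ∂t G) n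
  ∂t-⋆ F G n = begin
    ι (suc n) * (F ⋆ G) (suc n)                       ≈⟨ adiag-*ˡ (ι (suc n)) _ (suc n) 0 ⟩
    adiag (λ i j → ι (suc n) * (F i * G j)) (suc n) 0 ≈⟨ adiag-cong-on (suc n) 0 split-weight ⟩
    adiag (λ i j → left i j + right i j) (suc n) 0    ≈⟨ adiag-+ left right (suc n) 0 ⟩
    adiag left (suc n) 0 + adiag right (suc n) 0      ≈⟨ +-cong left-sum right-sum ⟩
    (∂t F ⋆ G) n + (F ⋆ ∂t G) n                       ∎
    where
    left right : ℕ → ℕ → Carrier
    left i j = (ι i * F i) * G j
    right i j = F i * (ι j * G j)

    split-weight : ∀ i j → i ℕ.+ j ≡ suc n ℕ.+ 0 → ι (suc n) * (F i * G j) ≈ left i j + right i j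
    split-weight i j i+j≡n+1 = begin
      ι (suc n) * (F i * G j)
        ≈⟨ *-congʳ (≈-reflexive (cong ι (trans (sym (ℕP.+-identityʳ (suc n))) (sym i+j≡n+1)))) ⟩
      ι (i ℕ.+ j) * (F i * G j)   ≈⟨ *-congʳ (ι-+ i j) ⟩
      (ι i + ι j) * (F i * G j)
        ≈⟨ solve 4 (λ a b f g → (a :+ b) :* (f :* g) := (a :* f) :* g :+ f :* (b :* g)) ≈-refl (ι i) (ι j) (F i) (G j) ⟩
      left i j + right i j ∎

    -- the term i = 0 of the left sum has weight ι 0 = 0
    left-sum : adiag left (suc n) 0 ≈ (∂t F ⋆ G) n
    left-sum = begin
      adiag left (suc n) 0                                   ≈⟨ adiag-peel left n 0 ⟩
      (∂t F ⋆ G) n + (0# * F 0) * G (n ℕ.+ 1)                ≈⟨ +-congˡ (≈-trans (*-congʳ (zeroˡ (F 0))) (zeroˡ _)) ⟩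
      (∂t F ⋆ G) n + 0#                                      ≈⟨ +-identityʳ _ ⟩
      (∂t F ⋆ G) n                                           ∎

    -- the term j = 0 of the right sum has weight ι 0 = 0
    right-sum : adiag right (suc n) 0 ≈ (F ⋆ ∂t G) n
    right-sum = begin
      F (suc n) * (0# * G 0) + adiag right n 1  ≈⟨ +-congʳ (≈-trans (*-congˡ (zeroˡ (G 0))) (zeroʳ _)) ⟩
      0# + adiag right n 1                      ≈⟨ +-identityˡ _ ⟩
      adiag right n 1                           ≡⟨ adiag-reindex right n 0 ⟩
      (F ⋆ ∂t G) n                              ∎

  -- Weights k with (n+1)·k(n+1) = k(n), i.e. k(n) = k(0)/n!, turn the powers
  -- P n = cⁿ into the exponential series e^{ct}, whose t-derivative is c·e^{ct}.
  weighted-powers-∂t : ∀ (k P : Seq) c → (∀ n → ι (suc n) * k (suc n) ≈ k n) → (∀ n → P (suc n) ≈ c * P n) →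
                       ∀ n → ∂t (λ m → k m * P m) n ≈ c * (k n * P n)
  weighted-powers-∂t k P c ι-k P-step n = begin
    ι (suc n) * (k (suc n) * P (suc n))   ≈⟨ ≈-sym (*-assoc _ _ _) ⟩
    (ι (suc n) * k (suc n)) * P (suc n)   ≈⟨ *-cong (ι-k n) (P-step n) ⟩
    k n * (c * P n)                       ≈⟨ solve 3 (λ k c p → k :* (c :* p) := c :* (k :* p)) ≈-refl (k n) c (P n) ⟩
    c * (k n * P n)                       ∎

  module WithDerivation (∂ : Carrier → Carrier) (∂-cong : ∀ {a b} → a ≈ b → ∂ a ≈ ∂ b)
                        (∂-+ : ∀ a b → ∂ (a + b) ≈ ∂ a + ∂ b)
                        (∂-* : ∀ a b → ∂ (a * b) ≈ ∂ a * b + a * ∂ b) where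

    Flows : Seq → Set ℓ
    Flows F = ∀ n → ∂t F n ≈ ∂ (F n)

    flows-resp : ∀ F G → F ≋ G → Flows F → Flows G
    flows-resp F G F≋G flowF n = begin
      ι (suc n) * G (suc n) ≈⟨ *-congˡ (≈-sym (F≋G (suc n))) ⟩
      ι (suc n) * F (suc n) ≈⟨ flowF n ⟩
      ∂ (F n)               ≈⟨ ∂-cong (F≋G n) ⟩
      ∂ (G n)               ∎

    flows-unique : (inv : ℕ → Carrier) → (∀ n → inv n * ι (suc n) ≈ 1#) →
                   ∀ F G → Flows F → Flows G → F 0 ≈ G 0 → F ≋ G
    flows-unique inv inv-ι F G flowF flowG F0≈G0 zero = F0≈G0
    flows-unique inv inv-ι F G flowF flowG F0≈G0 (suc n) = begin
      F (suc n)                         ≈⟨ ≈-sym (cancel (F (suc n))) ⟩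
      inv n * (ι (suc n) * F (suc n))   ≈⟨ *-congˡ (flowF n) ⟩
      inv n * ∂ (F n)                   ≈⟨ *-congˡ (∂-cong (flows-unique inv inv-ι F G flowF flowG F0≈G0 n)) ⟩
      inv n * ∂ (G n)                   ≈⟨ *-congˡ (≈-sym (flowG n)) ⟩
      inv n * (ι (suc n) * G (suc n))   ≈⟨ cancel (G (suc n)) ⟩
      G (suc n)                         ∎
      where
      cancel : ∀ a → inv n * (ι (suc n) * a) ≈ a
      cancel a = ≈-trans (≈-sym (*-assoc _ _ a)) (≈-trans (*-congʳ (inv-ι n)) (*-identityˡ a))

    ∂-const-* : ∀ k a → ∂ k ≈ 0# → ∂ (k * a) ≈ k * ∂ a
    ∂-const-* k a ∂k≈0 = begin
      ∂ (k * a)             ≈⟨ ∂-* k a ⟩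
      ∂ k * a + k * ∂ a     ≈⟨ +-congʳ (≈-trans (*-congʳ ∂k≈0) (zeroˡ a)) ⟩
      0# + k * ∂ a          ≈⟨ +-identityˡ _ ⟩
      k * ∂ a               ∎

    ∂-⋆-const : ∀ F E → (∀ n → ∂ (E n) ≈ 0#) → ∀ n → ∂ ((F ⋆ E) n) ≈ ((λ i → ∂ (F i)) ⋆ E) n
    ∂-⋆-const F E ∂E≈0 n = ≈-trans (∂-adiag _ n 0) (adiag-cong n 0 ∂-term)
      where
      ∂-adiag : ∀ h k m → ∂ (adiag h k m) ≈ adiag (λ i j → ∂ (h i j)) k m
      ∂-adiag h zero m = ≈-refl
      ∂-adiag h (suc k) m = ≈-trans (∂-+ _ _) (+-congˡ (∂-adiag h k (suc m)))

      ∂-term : ∀ i j → ∂ (F i * E j) ≈ ∂ (F i) * E j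
      ∂-term i j = begin
        ∂ (F i * E j)                   ≈⟨ ∂-* (F i) (E j) ⟩
        ∂ (F i) * E j + F i * ∂ (E j)   ≈⟨ +-congˡ (≈-trans (*-congˡ (∂E≈0 j)) (zeroʳ (F i))) ⟩
        ∂ (F i) * E j + 0#              ≈⟨ +-identityʳ _ ⟩
        ∂ (F i) * E j                   ∎

    flows-factor : ∀ u c G E → ∂ u ≈ u * c → Flows G →
                   (∀ n → ∂t E n ≈ c * E n) → (∀ n → ∂ (E n) ≈ 0#) → Flows (u · (G ⋆ E))
    flows-factor u c G E ∂u flowG ∂tE ∂E≈0 n = begin
      ι (suc n) * (u * (G ⋆ E) (suc n))
        ≈⟨ solve 3 (λ a u x → a :* (u :* x) := u :* (a :* x)) ≈-refl (ι (suc n)) u _ ⟩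
      u * ∂t (G ⋆ E) n                                    ≈⟨ *-congˡ (∂t-⋆ G E n) ⟩
      u * ((∂t G ⋆ E) n + (G ⋆ ∂t E) n)
        ≈⟨ *-congˡ (+-cong (⋆-cong flowG (λ _ → ≈-refl) n) (⋆-cong (λ _ → ≈-refl) ∂tE n)) ⟩
      u * (((λ i → ∂ (G i)) ⋆ E) n + (G ⋆ (c · E)) n)
        ≈⟨ *-congˡ (+-cong (≈-sym (∂-⋆-const G E ∂E≈0 n)) (⋆-·ʳ c G E n)) ⟩
      u * (∂ ((G ⋆ E) n) + c * (G ⋆ E) n)
        ≈⟨ solve 4 (λ u c d x → u :* (d :+ c :* x) := (u :* c) :* x :+ u :* d) ≈-refl u c _ _ ⟩
      (u * c) * (G ⋆ E) n + u * ∂ ((G ⋆ E) n)             ≈⟨ +-congʳ (*-congʳ (≈-sym ∂u)) ⟩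
      ∂ u * (G ⋆ E) n + u * ∂ ((G ⋆ E) n)                 ≈⟨ ≈-sym (∂-* u _) ⟩
      ∂ (u * (G ⋆ E) n)                                   ∎

    weighted-orbit-flows : ∀ (k P : Seq) → (∀ n → ∂ (k n) ≈ 0#) → (∀ n → ι (suc n) * k (suc n) ≈ k n) →
                           (∀ n → P (suc n) ≈ ∂ (P n)) → Flows (λ n → k n * P n)
    weighted-orbit-flows k P ∂k≈0 ι-k P-step n = begin
      ι (suc n) * (k (suc n) * P (suc n))   ≈⟨ ≈-sym (*-assoc _ _ _) ⟩
      (ι (suc n) * k (suc n)) * P (suc n)   ≈⟨ *-cong (ι-k n) (P-step n) ⟩
      k n * ∂ (P n)                         ≈⟨ ≈-sym (∂-const-* (k n) (P n) (∂k≈0 n)) ⟩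
      ∂ (k n * P n)                         ∎

    weighted-powers-const : ∀ (k P : Seq) c → (∀ n → ∂ (k n) ≈ 0#) → ∂ c ≈ 0# → ∂ (P 0) ≈ 0# →
                            (∀ n → P (suc n) ≈ c * P n) → ∀ n → ∂ (k n * P n) ≈ 0#
    weighted-powers-const k P c ∂k≈0 ∂c≈0 ∂P₀≈0 P-step n = begin
      ∂ (k n * P n)   ≈⟨ ∂-const-* (k n) (P n) (∂k≈0 n) ⟩
      k n * ∂ (P n)   ≈⟨ *-congˡ (∂P≈0 n) ⟩
      k n * 0#        ≈⟨ zeroʳ (k n) ⟩
      0#              ∎
      where
      ∂P≈0 : ∀ n → ∂ (P n) ≈ 0#
      ∂P≈0 zero = ∂P₀≈0
      ∂P≈0 (suc n) = begin
        ∂ (P (suc n))   ≈⟨ ∂-cong (P-step n) ⟩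
        ∂ (c * P n)     ≈⟨ ∂-const-* c (P n) ∂c≈0 ⟩
        c * ∂ (P n)     ≈⟨ *-congˡ (∂P≈0 n) ⟩
        c * 0#          ≈⟨ zeroʳ c ⟩
        0#              ∎

open +-*-Solver using (solve; _:+_; _:*_; _:=_; con)

-- The pairing ⟨h, p⟩ = Σ_{(q,e) ∈ p} q · h(e) of a test function h on exponents
-- with a Laurent polynomial p.  Coefficients are the pairings with indicator
-- functions, and conversely pairings only depend on coefficients (pair-≈L).
pair : (Exp → ℚ) → LPoly → ℚ
pair h [] = 0ℚ
pair h ((q , e) ∷ p) = q ℚ.* h e ℚ.+ pair h p

_≟E_ : DecidableEquality Exp
_≟E_ = ≡-dec ℤ._≟_

indicator : Exp → Exp → ℚ
indicator e e′ with e′ ≟E e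
... | yes _ = 1ℚ
... | no _ = 0ℚ

coeff-pair : ∀ p e → coeff p e ≡ pair (indicator e) p
coeff-pair [] e = refl
coeff-pair ((q , e′) ∷ p) e with e′ ≟E e
... | yes _ = cong₂ ℚ._+_ (sym (ℚP.*-identityʳ q)) (coeff-pair p e)
... | no _ = trans (coeff-pair p e) (sym (trans (cong (ℚ._+ pair (indicator e) p) (ℚP.*-zeroʳ q)) (ℚP.+-identityˡ _)))

pair-++ : ∀ h p q → pair h (p ++ q) ≡ pair h p ℚ.+ pair h q
pair-++ h [] q = sym (ℚP.+-identityˡ _)
pair-++ h ((r , e) ∷ p) q rewrite pair-++ h p q = sym (ℚP.+-assoc (r ℚ.* h e) (pair h p) (pair h q))

pair-scale : ∀ h r p → pair h (scaleL r p) ≡ r ℚ.* pair h p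
pair-scale h r [] = sym (ℚP.*-zeroʳ r)
pair-scale h r ((q , e) ∷ p) rewrite pair-scale h r p =
  solve 4 (λ r q x y → r :* q :* x :+ r :* y := r :* (q :* x :+ y)) refl r q (h e) (pair h p)

pair-congʰ : ∀ {h h′} → (∀ e → h e ≡ h′ e) → ∀ p → pair h p ≡ pair h′ p
pair-congʰ h≗h′ [] = refl
pair-congʰ h≗h′ ((q , e) ∷ p) = cong₂ (λ a b → q ℚ.* a ℚ.+ b) (h≗h′ e) (pair-congʰ h≗h′ p)

pair-+ʰ : ∀ h₁ h₂ p → pair (λ e → h₁ e ℚ.+ h₂ e) p ≡ pair h₁ p ℚ.+ pair h₂ p
pair-+ʰ h₁ h₂ [] = sym (ℚP.+-identityˡ _)
pair-+ʰ h₁ h₂ ((q , e) ∷ p) rewrite pair-+ʰ h₁ h₂ p =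
  solve 5 (λ q a b x y → q :* (a :+ b) :+ (x :+ y) := (q :* a :+ x) :+ (q :* b :+ y))
    refl q (h₁ e) (h₂ e) (pair h₁ p) (pair h₂ p)

pair-*ʰ : ∀ a h p → pair (λ e → a ℚ.* h e) p ≡ a ℚ.* pair h p
pair-*ʰ a h [] = sym (ℚP.*-zeroʳ a)
pair-*ʰ a h ((q , e) ∷ p) rewrite pair-*ʰ a h p =
  solve 4 (λ a q x y → q :* (a :* x) :+ a :* y := a :* (q :* x :+ y)) refl a q (h e) (pair h p)

pair-0ʰ : ∀ p → pair (λ _ → 0ℚ) p ≡ 0ℚ
pair-0ʰ [] = refl
pair-0ʰ ((q , e) ∷ p) rewrite pair-0ʰ p | ℚP.*-zeroʳ q = refl

coeff-++ : ∀ p q e → coeff (p ++ q) e ≡ coeff p e ℚ.+ coeff q e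
coeff-++ p q e =
  trans (coeff-pair (p ++ q) e) (trans (pair-++ (indicator e) p q) (sym (cong₂ ℚ._+_ (coeff-pair p e) (coeff-pair q e))))

coeff-scale : ∀ r p e → coeff (scaleL r p) e ≡ r ℚ.* coeff p e
coeff-scale r p e =
  trans (coeff-pair (scaleL r p) e) (trans (pair-scale (indicator e) r p) (cong (r ℚ.*_) (sym (coeff-pair p e))))

-- Deleting all terms with a given exponent; used to show that a Laurent
-- polynomial with vanishing coefficients pairs to 0 with everything.
remove : Exp → LPoly → LPoly
remove e [] = []
remove e ((q , e′) ∷ p) with e′ ≟E e
... | yes _ = remove e p
... | no _ = (q , e′) ∷ remove e p

pair-remove : ∀ h e p → pair h p ≡ coeff p e ℚ.* h e ℚ.+ pair h (remove e p)
pair-remove h e [] = sym (trans (cong (ℚ._+ 0ℚ) (ℚP.*-zeroˡ (h e))) refl)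
pair-remove h e ((q , e′) ∷ p) with e′ ≟E e
... | yes refl rewrite pair-remove h e′ p =
  solve 4 (λ q x c y → q :* x :+ (c :* x :+ y) := (q :+ c) :* x :+ y) refl q (h e′) (coeff p e′) (pair h (remove e′ p))
... | no _ rewrite pair-remove h e p =
  solve 5 (λ q x c y z → q :* x :+ (c :* y :+ z) := c :* y :+ (q :* x :+ z)) refl q (h e′) (coeff p e) (h e) (pair h (remove e p))

coeff-remove-same : ∀ e p → coeff (remove e p) e ≡ 0ℚ
coeff-remove-same e [] = refl
coeff-remove-same e ((q , e′) ∷ p) with e′ ≟E e
... | yes _ = coeff-remove-same e p
... | no e′≢e with e′ ≟E e
...   | yes e′≡e = ⊥-elim (e′≢e e′≡e)
...   | no _ = coeff-remove-same e p

coeff-remove-other : ∀ e e′ p → ¬ e′ ≡ e → coeff (remove e p) e′ ≡ coeff p e′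
coeff-remove-other e e′ [] e′≢e = refl
coeff-remove-other e e′ ((q , e″) ∷ p) e′≢e with e″ ≟E e
... | yes refl with e″ ≟E e′
...   | yes e″≡e′ = ⊥-elim (e′≢e (sym e″≡e′))
...   | no _ = coeff-remove-other e e′ p e′≢e
coeff-remove-other e e′ ((q , e″) ∷ p) e′≢e | no _ with e″ ≟E e′
...   | yes _ = cong (q ℚ.+_) (coeff-remove-other e e′ p e′≢e)
...   | no _ = coeff-remove-other e e′ p e′≢e

length-remove : ∀ e p → length (remove e p) ≤ length p
length-remove e [] = z≤n
length-remove e ((q , e′) ∷ p) with e′ ≟E e
... | yes _ = ℕP.m≤n⇒m≤1+n (length-remove e p)
... | no _ = s≤s (length-remove e p)

length-remove-head : ∀ q e p → length (remove e ((q , e) ∷ p)) ≤ length p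
length-remove-head q e p with e ≟E e
... | yes _ = length-remove e p
... | no e≢e = ⊥-elim (e≢e refl)

Vanishing : LPoly → Set
Vanishing p = ∀ e → coeff p e ≡ 0ℚ

vanishing-remove : ∀ e p → Vanishing p → Vanishing (remove e p)
vanishing-remove e p p≈0 e′ with e′ ≟E e
... | yes refl = coeff-remove-same e′ p
... | no e′≢e = trans (coeff-remove-other e e′ p e′≢e) (p≈0 e′)

-- A Laurent polynomial all of whose coefficients vanish pairs to 0 with every
-- test function (induction on the length of the term list, bounded by n).
pair-vanishing : ∀ n p → length p ≤ n → Vanishing p → ∀ h → pair h p ≡ 0ℚ
pair-vanishing n [] _ _ h = refl
pair-vanishing (suc n) ((q , e) ∷ p) (s≤s |p|≤n) p≈0 h = begin
  pair h ((q , e) ∷ p)                                   ≡⟨ pair-remove h e ((q , e) ∷ p) ⟩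
  coeff ((q , e) ∷ p) e ℚ.* h e ℚ.+ pair h rest          ≡⟨ cong₂ ℚ._+_ head-term rest-term ⟩
  0ℚ ℚ.+ 0ℚ                                              ≡⟨ ℚP.+-identityˡ 0ℚ ⟩
  0ℚ                                                     ∎
  where
  open ≡-Reasoning
  rest : LPoly
  rest = remove e ((q , e) ∷ p)
  head-term : coeff ((q , e) ∷ p) e ℚ.* h e ≡ 0ℚ
  head-term = trans (cong (ℚ._* h e) (p≈0 e)) (ℚP.*-zeroˡ (h e))
  rest-term : pair h rest ≡ 0ℚ
  rest-term = pair-vanishing n rest (ℕP.≤-trans (length-remove-head q e p) |p|≤n) (vanishing-remove e ((q , e) ∷ p) p≈0) h

pair-≈L : ∀ p p′ → p ≈L p′ → ∀ h → pair h p ≡ pair h p′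
pair-≈L p p′ p≈p′ h = begin
  pair h p                                                ≡⟨ solve 2 (λ a b → a := (a :+ con (ℚ.- 1ℚ) :* b) :+ b) refl (pair h p) (pair h p′) ⟩
  (pair h p ℚ.+ (ℚ.- 1ℚ) ℚ.* pair h p′) ℚ.+ pair h p′    ≡⟨ cong (ℚ._+ pair h p′) (sym difference) ⟩
  pair h (p ++ negL p′) ℚ.+ pair h p′                     ≡⟨ cong (ℚ._+ pair h p′) (pair-vanishing _ (p ++ negL p′) ℕP.≤-refl vanishes h) ⟩
  0ℚ ℚ.+ pair h p′                                        ≡⟨ ℚP.+-identityˡ _ ⟩
  pair h p′                                               ∎
  where
  open ≡-Reasoning
  difference : pair h (p ++ negL p′) ≡ pair h p ℚ.+ (ℚ.- 1ℚ) ℚ.* pair h p′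
  difference = trans (pair-++ h p (negL p′)) (cong (pair h p ℚ.+_) (pair-scale h (ℚ.- 1ℚ) p′))
  vanishes : Vanishing (p ++ negL p′)
  vanishes e rewrite coeff-++ p (negL p′) e | coeff-scale (ℚ.- 1ℚ) p′ e | p≈p′ e =
    solve 1 (λ a → a :+ con (ℚ.- 1ℚ) :* a := con 0ℚ) refl (coeff p′ e)

≈L-by-pairing : ∀ p p′ → (∀ h → pair h p ≡ pair h p′) → p ≈L p′
≈L-by-pairing p p′ pairings e = trans (coeff-pair p e) (trans (pairings (indicator e)) (sym (coeff-pair p′ e)))

0E : Exp
0E = ℤ.0ℤ ∷ ℤ.0ℤ ∷ ℤ.0ℤ ∷ ℤ.0ℤ ∷ []

addExp-comm : ∀ a b → addExp a b ≡ addExp b a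
addExp-comm (a₁ ∷ a₂ ∷ a₃ ∷ a₄ ∷ []) (b₁ ∷ b₂ ∷ b₃ ∷ b₄ ∷ []) =
  cong₂ _∷_ (ℤP.+-comm a₁ b₁) (cong₂ _∷_ (ℤP.+-comm a₂ b₂) (cong₂ _∷_ (ℤP.+-comm a₃ b₃) (cong₂ _∷_ (ℤP.+-comm a₄ b₄) refl)))

addExp-assoc : ∀ a b c → addExp (addExp a b) c ≡ addExp a (addExp b c)
addExp-assoc (a₁ ∷ a₂ ∷ a₃ ∷ a₄ ∷ []) (b₁ ∷ b₂ ∷ b₃ ∷ b₄ ∷ []) (c₁ ∷ c₂ ∷ c₃ ∷ c₄ ∷ []) =
  cong₂ _∷_ (ℤP.+-assoc a₁ b₁ c₁) (cong₂ _∷_ (ℤP.+-assoc a₂ b₂ c₂)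
    (cong₂ _∷_ (ℤP.+-assoc a₃ b₃ c₃) (cong₂ _∷_ (ℤP.+-assoc a₄ b₄ c₄) refl)))

addExp-identityˡ : ∀ a → addExp 0E a ≡ a
addExp-identityˡ (a₁ ∷ a₂ ∷ a₃ ∷ a₄ ∷ []) =
  cong₂ _∷_ (ℤP.+-identityˡ a₁) (cong₂ _∷_ (ℤP.+-identityˡ a₂) (cong₂ _∷_ (ℤP.+-identityˡ a₃) (cong₂ _∷_ (ℤP.+-identityˡ a₄) refl)))

pair-row : ∀ h r e (φ : ℚ × Exp → ℚ × Exp) → (∀ s f → φ (s , f) ≡ (r ℚ.* s , addExp e f)) →
           ∀ q → pair h (map φ q) ≡ r ℚ.* pair (λ b → h (addExp e b)) q
pair-row h r e φ φ-def [] = sym (ℚP.*-zeroʳ r)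
pair-row h r e φ φ-def ((s , f) ∷ q) rewrite φ-def s f | pair-row h r e φ φ-def q =
  solve 4 (λ r s x y → r :* s :* x :+ r :* y := r :* (s :* x :+ y)) refl r s (h (addExp e f)) (pair (λ b → h (addExp e b)) q)

pair-*L : ∀ h p q → pair h (p *L q) ≡ pair (λ a → pair (λ b → h (addExp a b)) q) p
pair-*L h [] q = refl
pair-*L h ((r , e) ∷ p) q =
  trans (pair-++ h (map _ q) (p *L q)) (cong₂ ℚ._+_ (pair-row h r e _ (λ s f → refl) q) (pair-*L h p q))

pair-swap : ∀ (g : Exp → Exp → ℚ) p q → pair (λ a → pair (g a) q) p ≡ pair (λ b → pair (λ a → g a b) p) q
pair-swap g [] q = sym (pair-0ʰ q)
pair-swap g ((r , a) ∷ p) q rewrite pair-swap g p q =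
  trans (cong (ℚ._+ pair (λ b → pair (λ a → g a b) p) q) (sym (pair-*ʰ r (g a) q)))
        (sym (pair-+ʰ (λ b → r ℚ.* g a b) (λ b → pair (λ a → g a b) p) q))

1L : LPoly
1L = const 1ℚ

+L-cong : ∀ {p p′ q q′} → p ≈L p′ → q ≈L q′ → (p +L q) ≈L (p′ +L q′)
+L-cong {p} {p′} {q} {q′} p≈p′ q≈q′ = ≈L-by-pairing (p +L q) (p′ +L q′) λ h →
  trans (pair-++ h p q) (trans (cong₂ ℚ._+_ (pair-≈L p p′ p≈p′ h) (pair-≈L q q′ q≈q′ h)) (sym (pair-++ h p′ q′)))

+L-assoc : ∀ p q r → ((p +L q) +L r) ≈L (p +L (q +L r))
+L-assoc p q r = ≈L-by-pairing ((p +L q) +L r) (p +L (q +L r)) λ h → begin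
  pair h ((p ++ q) ++ r)                  ≡⟨ pair-++ h (p ++ q) r ⟩
  pair h (p ++ q) ℚ.+ pair h r            ≡⟨ cong (ℚ._+ pair h r) (pair-++ h p q) ⟩
  (pair h p ℚ.+ pair h q) ℚ.+ pair h r    ≡⟨ ℚP.+-assoc (pair h p) (pair h q) (pair h r) ⟩
  pair h p ℚ.+ (pair h q ℚ.+ pair h r)    ≡⟨ cong (pair h p ℚ.+_) (sym (pair-++ h q r)) ⟩
  pair h p ℚ.+ pair h (q ++ r)            ≡⟨ sym (pair-++ h p (q ++ r)) ⟩
  pair h (p ++ (q ++ r))                  ∎
  where open ≡-Reasoning

+L-comm : ∀ p q → (p +L q) ≈L (q +L p)
+L-comm p q = ≈L-by-pairing (p +L q) (q +L p) λ h →
  trans (pair-++ h p q) (trans (ℚP.+-comm (pair h p) (pair h q)) (sym (pair-++ h q p)))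

+L-identityʳ : ∀ p → (p +L 0L) ≈L p
+L-identityʳ p = ≈L-by-pairing (p +L 0L) p λ h → trans (pair-++ h p []) (ℚP.+-identityʳ (pair h p))

negL-cong : ∀ {p q} → p ≈L q → negL p ≈L negL q
negL-cong {p} {q} p≈q = ≈L-by-pairing (negL p) (negL q) λ h →
  trans (pair-scale h (ℚ.- 1ℚ) p) (trans (cong (ℚ.- 1ℚ ℚ.*_) (pair-≈L p q p≈q h)) (sym (pair-scale h (ℚ.- 1ℚ) q)))

+L-inverseˡ : ∀ p → (negL p +L p) ≈L 0L
+L-inverseˡ p = ≈L-by-pairing (negL p +L p) 0L λ h →
  trans (pair-++ h (negL p) p) (trans (cong (ℚ._+ pair h p) (pair-scale h (ℚ.- 1ℚ) p))
    (solve 1 (λ a → con (ℚ.- 1ℚ) :* a :+ a := con 0ℚ) refl (pair h p)))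

*L-cong : ∀ {p p′ q q′} → p ≈L p′ → q ≈L q′ → (p *L q) ≈L (p′ *L q′)
*L-cong {p} {p′} {q} {q′} p≈p′ q≈q′ = ≈L-by-pairing (p *L q) (p′ *L q′) λ h →
  trans (pair-*L h p q) (trans (pair-≈L p p′ p≈p′ _)
    (trans (pair-congʰ (λ a → pair-≈L q q′ q≈q′ (λ b → h (addExp a b))) p′) (sym (pair-*L h p′ q′))))

*L-assoc : ∀ p q r → ((p *L q) *L r) ≈L (p *L (q *L r))
*L-assoc p q r = ≈L-by-pairing ((p *L q) *L r) (p *L (q *L r)) λ h → begin
  pair h ((p *L q) *L r)                                                   ≡⟨ pair-*L h (p *L q) r ⟩
  pair (λ a → pair (λ c → h (addExp a c)) r) (p *L q)                      ≡⟨ pair-*L _ p q ⟩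
  pair (λ a → pair (λ b → pair (λ c → h (addExp (addExp a b) c)) r) q) p
    ≡⟨ pair-congʰ (λ a → pair-congʰ (λ b → pair-congʰ (λ c → cong h (addExp-assoc a b c)) r) q) p ⟩
  pair (λ a → pair (λ b → pair (λ c → h (addExp a (addExp b c))) r) q) p
    ≡⟨ sym (pair-congʰ (λ a → pair-*L (λ e → h (addExp a e)) q r) p) ⟩
  pair (λ a → pair (λ e → h (addExp a e)) (q *L r)) p                      ≡⟨ sym (pair-*L h p (q *L r)) ⟩
  pair h (p *L (q *L r))                                                   ∎
  where open ≡-Reasoning

*L-comm : ∀ p q → (p *L q) ≈L (q *L p)
*L-comm p q = ≈L-by-pairing (p *L q) (q *L p) λ h → begin
  pair h (p *L q)                                ≡⟨ pair-*L h p q ⟩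
  pair (λ a → pair (λ b → h (addExp a b)) q) p   ≡⟨ pair-swap (λ a b → h (addExp a b)) p q ⟩
  pair (λ b → pair (λ a → h (addExp a b)) p) q   ≡⟨ pair-congʰ (λ b → pair-congʰ (λ a → cong h (addExp-comm a b)) p) q ⟩
  pair (λ b → pair (λ a → h (addExp b a)) p) q   ≡⟨ sym (pair-*L h q p) ⟩
  pair h (q *L p)                                ∎
  where open ≡-Reasoning

*L-identityˡ : ∀ p → (1L *L p) ≈L p
*L-identityˡ p = ≈L-by-pairing (1L *L p) p λ h → begin
  pair h (1L *L p)                                        ≡⟨ pair-*L h 1L p ⟩
  1ℚ ℚ.* pair (λ b → h (addExp 0E b)) p ℚ.+ 0ℚ            ≡⟨ ℚP.+-identityʳ _ ⟩
  1ℚ ℚ.* pair (λ b → h (addExp 0E b)) p                   ≡⟨ ℚP.*-identityˡ _ ⟩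
  pair (λ b → h (addExp 0E b)) p                          ≡⟨ pair-congʰ (λ b → cong h (addExp-identityˡ b)) p ⟩
  pair h p                                                ∎
  where open ≡-Reasoning

*L-distribʳ : ∀ p q r → ((q +L r) *L p) ≈L ((q *L p) +L (r *L p))
*L-distribʳ p q r = ≈L-by-pairing ((q +L r) *L p) ((q *L p) +L (r *L p)) λ h →
  trans (pair-*L h (q ++ r) p) (trans (pair-++ _ q r)
    (trans (cong₂ ℚ._+_ (sym (pair-*L h q p)) (sym (pair-*L h r p))) (sym (pair-++ h (q *L p) (r *L p)))))

LRing : CommutativeRing 0ℓ 0ℓ
LRing = record
  { Carrier = LPoly ; _≈_ = _≈L_ ; _+_ = _+L_ ; _*_ = _*L_ ; -_ = negL ; 0# = 0L ; 1# = 1L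
  ; isCommutativeRing = record
    { isRing = record
      { +-isAbelianGroup = record
        { isGroup = record
          { isMonoid = record
            { isSemigroup = record
              { isMagma = record
                { isEquivalence = record
                  { refl = λ _ → refl ; sym = λ p≈q e → sym (p≈q e) ; trans = λ p≈q q≈r e → trans (p≈q e) (q≈r e) }
                ; ∙-cong = λ {p} {p′} {q} {q′} → +L-cong {p} {p′} {q} {q′} }
              ; assoc = +L-assoc }
            ; identity = (λ p e → refl) , +L-identityʳ }
          ; inverse = +L-inverseˡ , (λ p e → trans (+L-comm p (negL p) e) (+L-inverseˡ p e))
          ; ⁻¹-cong = λ {p} {q} → negL-cong {p} {q} }
        ; comm = +L-comm }
      ; *-cong = λ {p} {p′} {q} {q′} → *L-cong {p} {p′} {q} {q′}
      ; *-assoc = *L-assoc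
      ; *-identity = *L-identityˡ , (λ p e → trans (*L-comm p 1L e) (*L-identityˡ p e))
      ; distrib = (λ p q r e → trans (*L-comm p (q +L r) e)
                                 (trans (*L-distribʳ p q r e) (+L-cong {q *L p} {p *L q} {r *L p} {p *L r} (*L-comm q p) (*L-comm r p) e)))
                , *L-distribʳ }
    ; *-comm = *L-comm } }

-- The embedding ℤ → ℚ used by Dterm: i/1 is already the normal form mkℚ i 1,
-- hence the embedding is additive and multiplicative.
ℤtoℚ-mkℚ : ∀ i → ℤtoℚ i ≡ ℚ.mkℚ i 0 (Cop.sym (1-coprimeTo ℤ.∣ i ∣))
ℤtoℚ-mkℚ i = ℚP.↥p/↧p≡p (ℚ.mkℚ i 0 (Cop.sym (1-coprimeTo ℤ.∣ i ∣)))

ℤtoℚ-+ : ∀ i j → ℤtoℚ (i ℤ.+ j) ≡ ℤtoℚ i ℚ.+ ℤtoℚ j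
ℤtoℚ-+ i j rewrite ℤtoℚ-mkℚ i | ℤtoℚ-mkℚ j =
  sym (cong (λ k → k ℚ./ 1) (cong₂ ℤ._+_ (ℤP.*-identityʳ i) (ℤP.*-identityʳ j)))

ℤtoℚ-* : ∀ i j → ℤtoℚ (i ℤ.* j) ≡ ℤtoℚ i ℚ.* ℤtoℚ j
ℤtoℚ-* i j rewrite ℤtoℚ-mkℚ i | ℤtoℚ-mkℚ j = refl

-- The transpose of D on test functions:  ⟨h, D p⟩ = ⟨Dᵀ h, p⟩.
Dᵀ : (Exp → ℚ) → Exp → ℚ
Dᵀ h e = pair h (Dterm (1ℚ , e))

pair-Dterm : ∀ h q e → pair h (Dterm (q , e)) ≡ q ℚ.* Dᵀ h e
pair-Dterm h q (a ∷ b ∷ c ∷ d ∷ []) =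
  solve 9 (λ q A B C Dd x y z w →
     q :* A :* x :+ (q :* B :* y :+ (q :* C :* z :+ (q :* Dd :* w :+ con 0ℚ)))
     := q :* (con 1ℚ :* A :* x :+ (con 1ℚ :* B :* y :+ (con 1ℚ :* C :* z :+ (con 1ℚ :* Dd :* w :+ con 0ℚ)))))
   refl q (ℤtoℚ a) (ℤtoℚ b) (ℤtoℚ c) (ℤtoℚ d) _ _ _ _

pair-D : ∀ h p → pair h (D p) ≡ pair (Dᵀ h) p
pair-D h [] = refl
pair-D h ((q , e) ∷ p) = trans (pair-++ h (Dterm (q , e)) (D p)) (cong₂ ℚ._+_ (pair-Dterm h q e) (pair-D h p))

D-cong : ∀ {p p′} → p ≈L p′ → D p ≈L D p′
D-cong {p} {p′} p≈p′ = ≈L-by-pairing (D p) (D p′) λ h →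
  trans (pair-D h p) (trans (pair-≈L p p′ p≈p′ (Dᵀ h)) (sym (pair-D h p′)))

D-+ : ∀ p q → D (p +L q) ≈L (D p +L D q)
D-+ p q = ≈L-by-pairing (D (p +L q)) (D p +L D q) λ h →
  trans (pair-D h (p ++ q)) (trans (pair-++ (Dᵀ h) p q)
    (sym (trans (pair-++ h (D p) (D q)) (cong₂ ℚ._+_ (pair-D h p) (pair-D h q)))))

shiftˡ : ∀ x y k → (x ℤ.+ k) ℤ.+ y ≡ (x ℤ.+ y) ℤ.+ k
shiftˡ x y k = trans (ℤP.+-assoc x k y) (trans (cong (λ t → x ℤ.+ t) (ℤP.+-comm k y)) (sym (ℤP.+-assoc x y k)))

shiftʳ : ∀ x y k → x ℤ.+ (y ℤ.+ k) ≡ (x ℤ.+ y) ℤ.+ k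
shiftʳ x y k = sym (ℤP.+-assoc x y k)

-- Leibniz rule on monomials:  D(x^{a+b}) = D(x^a)·x^b + x^a·D(x^b), transposed.
Dᵀ-addExp : ∀ h a b → Dᵀ h (addExp a b) ≡ Dᵀ (λ a′ → h (addExp a′ b)) a ℚ.+ Dᵀ (λ b′ → h (addExp a b′)) b
Dᵀ-addExp h (a₁ ∷ a₂ ∷ a₃ ∷ a₄ ∷ []) (b₁ ∷ b₂ ∷ b₃ ∷ b₄ ∷ [])
  rewrite ℤtoℚ-+ a₁ b₁ | ℤtoℚ-+ a₂ b₂ | ℤtoℚ-+ a₃ b₃ | ℤtoℚ-+ a₄ b₄
        | shiftˡ a₂ b₂ (+ 1) | shiftʳ a₂ b₂ (+ 1) | shiftˡ a₁ b₁ (+ 1) | shiftʳ a₁ b₁ (+ 1)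
        | shiftˡ a₃ b₃ (+ 1) | shiftʳ a₃ b₃ (+ 1) | shiftˡ a₄ b₄ (+ 1) | shiftʳ a₄ b₄ (+ 1)
        | shiftˡ a₂ b₂ (ℤ.- + 1) | shiftʳ a₂ b₂ (ℤ.- + 1) | shiftˡ a₄ b₄ (ℤ.- + 1) | shiftʳ a₄ b₄ (ℤ.- + 1) =
  solve 12 (λ A₁ A₂ A₃ A₄ B₁ B₂ B₃ B₄ x y z w →
     con 1ℚ :* (A₁ :+ B₁) :* x :+ (con 1ℚ :* (A₂ :+ B₂) :* y :+ (con 1ℚ :* (A₃ :+ B₃) :* z :+ (con 1ℚ :* (A₄ :+ B₄) :* w :+ con 0ℚ)))
     := (con 1ℚ :* A₁ :* x :+ (con 1ℚ :* A₂ :* y :+ (con 1ℚ :* A₃ :* z :+ (con 1ℚ :* A₄ :* w :+ con 0ℚ))))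
      :+ (con 1ℚ :* B₁ :* x :+ (con 1ℚ :* B₂ :* y :+ (con 1ℚ :* B₃ :* z :+ (con 1ℚ :* B₄ :* w :+ con 0ℚ)))))
   refl (ℤtoℚ a₁) (ℤtoℚ a₂) (ℤtoℚ a₃) (ℤtoℚ a₄) (ℤtoℚ b₁) (ℤtoℚ b₂) (ℤtoℚ b₃) (ℤtoℚ b₄) _ _ _ _

D-* : ∀ p q → D (p *L q) ≈L ((D p *L q) +L (p *L D q))
D-* p q = ≈L-by-pairing (D (p *L q)) ((D p *L q) +L (p *L D q)) λ h → begin
  pair h (D (p *L q))                                        ≡⟨ pair-D h (p *L q) ⟩
  pair (Dᵀ h) (p *L q)                                       ≡⟨ pair-*L (Dᵀ h) p q ⟩
  pair (λ a → pair (λ b → Dᵀ h (addExp a b)) q) p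
    ≡⟨ pair-congʰ (λ a → trans (pair-congʰ (λ b → Dᵀ-addExp h a b) q) (pair-+ʰ (onLeft h a) (onRight h a) q)) p ⟩
  pair (λ a → pair (onLeft h a) q ℚ.+ pair (onRight h a) q) p
    ≡⟨ pair-+ʰ _ _ p ⟩
  pair (λ a → pair (onLeft h a) q) p ℚ.+ pair (λ a → pair (onRight h a) q) p
    ≡⟨ cong₂ ℚ._+_ (pair-congʰ (λ a → sym (pair-swap (λ a′ b → h (addExp a′ b)) (Dterm (1ℚ , a)) q)) p)
                   (pair-congʰ (λ a → sym (pair-D (λ b → h (addExp a b)) q)) p) ⟩
  pair (Dᵀ (λ a → pair (λ b → h (addExp a b)) q)) p ℚ.+ pair (λ a → pair (λ b → h (addExp a b)) (D q)) p
    ≡⟨ cong₂ ℚ._+_ (trans (sym (pair-D _ p)) (sym (pair-*L h (D p) q))) (sym (pair-*L h p (D q))) ⟩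
  pair h (D p *L q) ℚ.+ pair h (p *L D q)                    ≡⟨ sym (pair-++ h (D p *L q) (p *L D q)) ⟩
  pair h ((D p *L q) +L (p *L D q))                          ∎
  where
  open ≡-Reasoning
  onLeft onRight : (Exp → ℚ) → Exp → Exp → ℚ
  onLeft h a b = Dᵀ (λ a′ → h (addExp a′ b)) a
  onRight h a b = Dᵀ (λ b′ → h (addExp a b′)) b

open PowerSeries LRing using (ι; _⋆_; ∂t; weighted-powers-∂t; module WithDerivation)
open WithDerivation D (λ {p} {p′} → D-cong {p} {p′}) D-+ D-*
  using (Flows; flows-resp; flows-unique; flows-factor; weighted-orbit-flows; weighted-powers-const)

const-+ : ∀ a b → (const a +L const b) ≈L const (a ℚ.+ b)
const-+ a b = ≈L-by-pairing (const a +L const b) (const (a ℚ.+ b)) λ h →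
  solve 3 (λ a b x → a :* x :+ (b :* x :+ con 0ℚ) := (a :+ b) :* x :+ con 0ℚ) refl a b (h 0E)

scale-as-product : ∀ r p → scaleL r p ≈L (const r *L p)
scale-as-product r p = ≈L-by-pairing (scaleL r p) (const r *L p) λ h → begin
  pair h (scaleL r p)                               ≡⟨ pair-scale h r p ⟩
  r ℚ.* pair h p                                    ≡⟨ cong (r ℚ.*_) (sym (pair-congʰ (λ b → cong h (addExp-identityˡ b)) p)) ⟩
  r ℚ.* pair (λ b → h (addExp 0E b)) p              ≡⟨ sym (ℚP.+-identityʳ _) ⟩
  r ℚ.* pair (λ b → h (addExp 0E b)) p ℚ.+ 0ℚ       ≡⟨ sym (pair-*L h (const r) p) ⟩
  pair h (const r *L p)                             ∎
  where open ≡-Reasoning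

-- Constants are killed by D: every term of D(x⁰y⁰z⁰w⁰) carries a zero exponent as factor.
D-const : ∀ a → D (const a) ≈L 0L
D-const a = ≈L-by-pairing (D (const a)) 0L λ h →
  solve 5 (λ a x y u w → a :* con 0ℚ :* x :+ (a :* con 0ℚ :* y :+ (a :* con 0ℚ :* u :+ (a :* con 0ℚ :* w :+ con 0ℚ)))
                   := con 0ℚ)
    refl a _ _ _ _

ι-const : ∀ n → ι n ≈L const (ℤtoℚ (+ n))
ι-const zero = ≈L-by-pairing [] (const 0ℚ) λ h → sym (trans (ℚP.+-identityʳ _) (ℚP.*-zeroˡ (h 0E)))
ι-const (suc n) e = begin
  coeff (1L +L ι n) e                           ≡⟨ +L-cong {1L} {1L} {ι n} {const (ℤtoℚ (+ n))} (λ _ → refl) (ι-const n) e ⟩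
  coeff (const 1ℚ +L const (ℤtoℚ (+ n))) e      ≡⟨ const-+ 1ℚ (ℤtoℚ (+ n)) e ⟩
  coeff (const (1ℚ ℚ.+ ℤtoℚ (+ n))) e           ≡⟨ cong (λ q → coeff (const q) e) (sym (ℤtoℚ-+ (+ 1) (+ n))) ⟩
  coeff (const (ℤtoℚ (+ suc n))) e              ∎
  where open ≡-Reasoning

reciprocal-inverse : ∀ m .{{_ : ℕ.NonZero m}} → (+ 1 ℚ./ m) ℚ.* ℤtoℚ (+ m) ≡ 1ℚ
reciprocal-inverse (suc k)
  rewrite ℤtoℚ-mkℚ (+ suc k) | ℚP.normalize-coprime {1} {k} (Cop.sym (Cop.sym (1-coprimeTo (suc k)))) =
  ℚP.*-inverseˡ (ℚ.mkℚ (+ suc k) 0 (Cop.sym (1-coprimeTo (suc k))))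

inverse-unique : ∀ f y y′ → y ℚ.* f ≡ 1ℚ → y′ ℚ.* f ≡ 1ℚ → y ≡ y′
inverse-unique f y y′ yf≡1 y′f≡1 = begin
  y                 ≡⟨ sym (ℚP.*-identityʳ y) ⟩
  y ℚ.* 1ℚ          ≡⟨ cong (y ℚ.*_) (sym y′f≡1) ⟩
  y ℚ.* (y′ ℚ.* f)  ≡⟨ solve 3 (λ y y′ f → y :* (y′ :* f) := y′ :* (y :* f)) refl y y′ f ⟩
  y′ ℚ.* (y ℚ.* f)  ≡⟨ cong (y′ ℚ.*_) yf≡1 ⟩
  y′ ℚ.* 1ℚ         ≡⟨ ℚP.*-identityʳ y′ ⟩
  y′                ∎
  where open ≡-Reasoning

-- (n+1) / (n+1)! = 1 / n!, as both are inverse to n!.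
invFact-suc : ∀ n → ℤtoℚ (+ suc n) ℚ.* invFact (suc n) ≡ invFact n
invFact-suc n = inverse-unique (ℤtoℚ (+ n!)) _ _ inverse (reciprocal-inverse n! {{n ℕP.!≢0}})
  where
  open ≡-Reasoning
  n! : ℕ
  n! = n ℕ.!
  inverse : ℤtoℚ (+ suc n) ℚ.* invFact (suc n) ℚ.* ℤtoℚ (+ n!) ≡ 1ℚ
  inverse = begin
    ℤtoℚ (+ suc n) ℚ.* invFact (suc n) ℚ.* ℤtoℚ (+ n!)
      ≡⟨ solve 3 (λ a b c → a :* b :* c := b :* (a :* c)) refl (ℤtoℚ (+ suc n)) (invFact (suc n)) (ℤtoℚ (+ n!)) ⟩
    invFact (suc n) ℚ.* (ℤtoℚ (+ suc n) ℚ.* ℤtoℚ (+ n!))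
      ≡⟨ cong (invFact (suc n) ℚ.*_) (sym (trans (cong ℤtoℚ (ℤP.pos-* (suc n) n!)) (ℤtoℚ-* (+ suc n) (+ n!)))) ⟩
    invFact (suc n) ℚ.* ℤtoℚ (+ (suc n ℕ.!))
      ≡⟨ reciprocal-inverse (suc n ℕ.!) {{suc n ℕP.!≢0}} ⟩
    1ℚ ∎

factorialWeight : ℕ → LPoly
factorialWeight n = const (invFact n)

factorialWeight-step : ∀ n → (ι (suc n) *L factorialWeight (suc n)) ≈L factorialWeight n
factorialWeight-step n e =
  trans (*L-cong {ι (suc n)} {const (ℤtoℚ (+ suc n))} {factorialWeight (suc n)} {factorialWeight (suc n)}
                 (ι-const (suc n)) (λ _ → refl) e)
        (cong (λ q → coeff (const q) e) (invFact-suc n))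

ι-invertible : ∀ n → (const (+ 1 ℚ./ suc n) *L ι (suc n)) ≈L 1L
ι-invertible n e =
  trans (*L-cong {const (+ 1 ℚ./ suc n)} {const (+ 1 ℚ./ suc n)} {ι (suc n)} {const (ℤtoℚ (+ suc n))}
                 (λ _ → refl) (ι-const (suc n)) e)
        (cong (λ q → coeff (const q) e) (reciprocal-inverse (suc n)))

Gen-flows : ∀ u → Flows (Gen u)
Gen-flows u = flows-resp weighted (Gen u) (λ n e → sym (scale-as-product (invFact n) (Dpow n u) e))
  (weighted-orbit-flows factorialWeight (λ n → Dpow n u) (λ n → D-const (invFact n)) factorialWeight-step (λ n e → refl))
  where
  weighted : ℕ → LPoly
  weighted n = factorialWeight n *L Dpow n u

expS-∂t : ∀ c n → ∂t (expS c) n ≈L (c *L expS c n)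
expS-∂t c n e = begin
  coeff (ι (suc n) *L expS c (suc n)) e
    ≡⟨ *L-cong {ι (suc n)} {ι (suc n)} {expS c (suc n)} {weighted (suc n)} (λ _ → refl) (as-weighted (suc n)) e ⟩
  coeff (ι (suc n) *L weighted (suc n)) e
    ≡⟨ weighted-powers-∂t factorialWeight (c ^L_) c factorialWeight-step (λ n e → refl) n e ⟩
  coeff (c *L weighted n) e
    ≡⟨ *L-cong {c} {c} {weighted n} {expS c n} (λ _ → refl) (λ e → sym (as-weighted n e)) e ⟩
  coeff (c *L expS c n) e ∎
  where
  open ≡-Reasoning
  weighted : ℕ → LPoly
  weighted n = factorialWeight n *L (c ^L n)
  as-weighted : ∀ n → expS c n ≈L weighted n
  as-weighted n = scale-as-product (invFact n) (c ^L n)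

expS-const : ∀ c → D c ≈L 0L → ∀ n → D (expS c n) ≈L 0L
expS-const c Dc≈0 n e =
  trans (D-cong {expS c n} {factorialWeight n *L (c ^L n)} (scale-as-product (invFact n) (c ^L n)) e)
        (weighted-powers-const factorialWeight (c ^L_) c (λ n → D-const (invFact n)) Dc≈0 (D-const 1ℚ) (λ n e → refl) n e)

-- The two concrete derivatives behind the theorem, with W−Y = w − y:
--   D(z x⁻¹) = zw·x⁻¹ − z x⁻²·xy = z x⁻¹ (w − y)   and   D(w − y) = xz − xz = 0.
-- Both sides are explicit finite sums; pairing with any h compares their terms.
m1 : ℤ
m1 = ℤ.- + 1

W−Y : LPoly
W−Y = W +L negL Y

D-zx⁻¹ : D (Z *L Xinv) ≈L ((Z *L Xinv) *L W−Y)
D-zx⁻¹ = ≈L-by-pairing (D (Z *L Xinv)) ((Z *L Xinv) *L W−Y) λ h →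
  solve 4 (λ zyx⁻¹ y⁻¹z² zwx⁻¹ z²w⁻¹ →
             con (ℚ.- 1ℚ) :* zyx⁻¹ :+ (con 0ℚ :* y⁻¹z² :+ (con 1ℚ :* zwx⁻¹ :+ (con 0ℚ :* z²w⁻¹ :+ con 0ℚ)))
          := con 1ℚ :* zwx⁻¹ :+ (con (ℚ.- 1ℚ) :* zyx⁻¹ :+ con 0ℚ))
    refl (h (m1 ∷ + 1 ∷ + 1 ∷ + 0 ∷ [])) (h (+ 0 ∷ m1 ∷ + 2 ∷ + 0 ∷ []))
         (h (m1 ∷ + 0 ∷ + 1 ∷ + 1 ∷ [])) (h (+ 0 ∷ + 0 ∷ + 2 ∷ m1 ∷ []))

D-W−Y : D W−Y ≈L 0L
D-W−Y = ≈L-by-pairing (D W−Y) 0L λ h →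
  solve 6 (λ yw xy⁻¹zw w² xz y² xyzw⁻¹ →
             con 0ℚ :* yw :+ (con 0ℚ :* xy⁻¹zw :+ (con 0ℚ :* w² :+ (con 1ℚ :* xz
          :+ (con 0ℚ :* y² :+ (con (ℚ.- 1ℚ) :* xz :+ (con 0ℚ :* yw :+ (con 0ℚ :* xyzw⁻¹ :+ con 0ℚ)))))))
          := con 0ℚ)
    refl (h (+ 0 ∷ + 1 ∷ + 0 ∷ + 1 ∷ [])) (h (+ 1 ∷ m1 ∷ + 1 ∷ + 1 ∷ [])) (h (+ 0 ∷ + 0 ∷ + 0 ∷ + 2 ∷ []))
         (h (+ 1 ∷ + 0 ∷ + 1 ∷ + 0 ∷ [])) (h (+ 0 ∷ + 2 ∷ + 0 ∷ + 0 ∷ [])) (h (+ 1 ∷ + 1 ∷ + 1 ∷ m1 ∷ []))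

convAux-adiag : ∀ f g k m → convAux f g k m ≡ PowerSeries.adiag LRing (λ i j → f i *L g j) k m
convAux-adiag f g zero m = refl
convAux-adiag f g (suc k) m = cong ((f (suc k) *L g m) +L_) (convAux-adiag f g k (suc m))

lemma3p2 : Gen Z ≈S ((Z *L Xinv) ·S (Gen X *S expS (W +L negL Y)))
lemma3p2 n = subst (λ t → Gen Z n ≈L ((Z *L Xinv) *L t)) (sym (convAux-adiag (Gen X) (expS W−Y) n 0)) (Gen-Z≋RHS n)
  where
  RHS : ℕ → LPoly
  RHS m = (Z *L Xinv) *L (Gen X ⋆ expS W−Y) m

  RHS-flows : Flows RHS
  RHS-flows = flows-factor (Z *L Xinv) W−Y (Gen X) (expS W−Y) D-zx⁻¹ (Gen-flows X) (expS-∂t W−Y) (expS-const W−Y D-W−Y)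

  Gen-Z≋RHS : ∀ m → Gen Z m ≈L RHS m
  Gen-Z≋RHS = flows-unique (λ m → const (+ 1 ℚ./ suc m)) ι-invertible (Gen Z) RHS (Gen-flows Z) RHS-flows (λ e → refl)
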